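{- Let $n>1$, $p$ a prime with $p\nmid n$, and $m$ an integer with $2\le m\le n-1$. For $\delta\in S_m$ the following are equivalent: (a) $\delta\in S_m^0$; (b) $m-i-1\le\alpha_{m-1,\delta(i)}$ for all $0\le i\le m-1$; (c) $i+1-m+\alpha_{m-1,\delta(i)}=\alpha_{i,\delta(i)}$ for all $0\le i\le m-1$; (d) $\lceil\frac{p\delta(i)-i}n\rceil=\lceil\frac{p\delta(i)-m+1}n\rceil$ for all $0\le i\le m-1$.
   Context: $S_m$ is the group of permutations of $\{0,1,\dots,m-1\}$. For integers $i,j$, $\alpha_{i,j}=i-pj+n\lceil\frac{pj-i}n\rceil$. $S_m^0=\{\delta\in S_m:\sum_{i=0}^{m-1}\alpha_{i,\delta(i)}\text{ is minimal among all }\delta\in S_m\}$. -}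

module Defs where

open import Data.Nat using (ℕ; zero; suc)
open import Data.Integer using (ℤ; +_; -_; _+_; _-_; _*_; _/ℕ_; _≤_)
open import Data.Fin using (Fin; toℕ)
import Data.Fin as Fin
open import Data.Fin.Permutation using (Permutation′; _⟨$⟩ʳ_)

-- ⌈ a / n ⌉ for a natural divisor n > 0, defined as - ⌊ (- a) / n ⌋
-- (_/ℕ_ is floor division: remainder _%ℕ_ lies in [0, n)).
-- For n = 0 the value is junk (0); the theorem only uses n > 1.
⌈_/_⌉ : ℤ → ℕ → ℤ
⌈ a / zero ⌉ = + 0
⌈ a / suc k ⌉ = - ((- a) /ℕ suc k)

α : (n p : ℕ) → ℕ → ℕ → ℤ
α n p i j = (+ i - + p * + j) + + n * ⌈ (+ p * + j - + i) / n ⌉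

Σ : (m : ℕ) → (Fin m → ℤ) → ℤ
Σ zero f = + 0
Σ (suc m) f = f Fin.zero + Σ m (λ i → f (Fin.suc i))

cost : (n p m : ℕ) → Permutation′ m → ℤ
cost n p m δ = Σ m (λ i → α n p (toℕ i) (toℕ (δ ⟨$⟩ʳ i)))

InSm0 : (n p m : ℕ) → Permutation′ m → Set
InSm0 n p m δ = ∀ (σ : Permutation′ m) → cost n p m δ ≤ cost n p m σ

module Submission where

open import Defs
open import Data.Nat using (ℕ; _<_; _≤_)
import Data.Nat as ℕ
open import Data.Nat.Primality using (Prime)
open import Data.Nat.Divisibility using (_∣_)
open import Data.Integer using (+_; _+_; _-_)
import Data.Integer as ℤ
open import Data.Fin using (Fin; toℕ)
open import Data.Fin.Permutation using (Permutation′; _⟨$⟩ʳ_)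
open import Data.Product using (_×_)
open import Function.Bundles using (_⇔_)
open import Relation.Binary.PropositionalEquality using (_≡_)
open import Relation.Nullary using (¬_)

open import Data.Nat using (zero; suc; _∸_; z≤n; s≤s)
import Data.Nat.Properties as ℕP
open import Data.Nat.Primality using (prime⇒irreducible)
open import Data.Nat.Divisibility using (divides; ∣⇒≤)
open import Data.Nat.Coprimality using (Coprime; coprime-divisor)
import Data.Nat.Coprimality as Coprime
open import Data.Integer using (ℤ; -[1+_]; _*_; -_; ∣_∣; _/ℕ_; _%ℕ_)
import Data.Integer.Properties as ℤP
open import Data.Integer.DivMod using (a≡a%ℕn+[a/ℕn]*n; n%ℕd<d)
open import Data.Integer.Tactic.RingSolver using (solve-∀)
open import Data.Fin using (punchIn; opposite)
import Data.Fin as Fin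
import Data.Fin.Properties as FinP
open import Data.Fin.Permutation using (_∘ₚ_)
import Data.Fin.Permutation as Perm
open import Data.Product using (Σ-syntax; ∃-syntax; _,_; proj₁; proj₂)
open import Data.Sum using (inj₁; inj₂)
open import Function.Bundles using (mk⇔; Equivalence)
open import Function.Definitions using (Injective)
open import Function.Construct.Identity using (⇔-id)
open import Function.Construct.Symmetry using (⇔-sym)
open import Function.Construct.Composition using (_⇔-∘_)
open import Relation.Binary.PropositionalEquality using (refl; sym; trans; cong; cong₂; subst; subst₂; module ≡-Reasoning)
open import Relation.Nullary using (yes; no; contradiction)
open import Algebra.Properties.Ring ℤP.+-*-ring using (x[y-z]≈xy-xz)
open import Algebra.Properties.Semiring.Sum ℕP.+-*-semiring
  using (sum; sum-cong-≗; sum-replicate-zero; sum-permute; ∑-distrib-+; *-distribˡ-sum)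

-- Write N = n and k = m - 1. The entry α_{i,j} is the remainder of i - p j modulo N, so
-- comparing row i ≤ k with row k gives  α_{i,j} + (k - i) = α_{k,j} + N c_{i,j},  where the
-- carry c_{i,j} = ⌈(p j - i)/N⌉ - ⌈(p j - k)/N⌉ is a natural number that vanishes iff
-- k - i ≤ α_{k,j}.  Each of (b), (c), (d) says exactly that every carry c_{i,δ(i)} vanishes.
-- Summing over i, the cost of σ is  Σ_j α_{k,j} - Σ_i (k - i) + N Σ_i c_{i,σ(i)},  so the
-- minimal permutations are those without carries, provided one exists.  As p is invertible
-- modulo N and m < N, the values α_{k,j} (j < m) are distinct; listing them in decreasing
-- order gives σ with α_{k,σ(i)} ≥ k - i, hence without carries.

subst₂-⇔ : ∀ {a b ℓ} {A : Set a} {B : Set b} (R : A → B → Set ℓ) {x x′ y y′} →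
           x ≡ x′ → y ≡ y′ → R x y ⇔ R x′ y′
subst₂-⇔ R refl refl = ⇔-id _

Π-cong-⇔ : ∀ {a b c} {I : Set a} {A : I → Set b} {B : I → Set c} →
           (∀ i → A i ⇔ B i) → (∀ i → A i) ⇔ (∀ i → B i)
Π-cong-⇔ A⇔B = mk⇔ (λ f i → Equivalence.to (A⇔B i) (f i)) (λ g i → Equivalence.from (A⇔B i) (g i))

Σ≡+sum : ∀ k {f : Fin k → ℤ} {g : Fin k → ℕ} → (∀ i → f i ≡ + g i) → Σ k f ≡ + sum g
Σ≡+sum zero _ = refl
Σ≡+sum (suc k) f≗g = cong₂ _+_ (f≗g Fin.zero) (Σ≡+sum k (λ i → f≗g (Fin.suc i)))

sum≡0⇒≡0 : ∀ {k} (f : Fin k → ℕ) → sum f ≡ 0 → ∀ i → f i ≡ 0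
sum≡0⇒≡0 f eq Fin.zero = ℕP.m+n≡0⇒m≡0 (f Fin.zero) eq
sum≡0⇒≡0 f eq (Fin.suc i) = sum≡0⇒≡0 (λ i → f (Fin.suc i)) (ℕP.m+n≡0⇒n≡0 (f Fin.zero) eq) i

≡0⇒sum≡0 : ∀ {k} (f : Fin k → ℕ) → (∀ i → f i ≡ 0) → sum f ≡ 0
≡0⇒sum≡0 {k} f f≗0 = trans (sum-cong-≗ f≗0) (sum-replicate-zero k)

argmin : ∀ {k} (v : Fin (suc k) → ℕ) → ∃[ j ] (∀ x → v j ≤ v x)
argmin {zero} v = Fin.zero , λ { Fin.zero → ℕP.≤-refl }
argmin {suc k} v with argmin (λ x → v (Fin.suc x))
... | j , min with v Fin.zero ℕP.≤? v (Fin.suc j)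
...   | yes v₀≤ = Fin.zero , λ { Fin.zero → ℕP.≤-refl ; (Fin.suc x) → ℕP.≤-trans v₀≤ (min x) }
...   | no v₀≰ = Fin.suc j , λ { Fin.zero → ℕP.<⇒≤ (ℕP.≰⇒> v₀≰) ; (Fin.suc x) → min x }

sort-ascending : ∀ k c (v : Fin k → ℕ) → Injective _≡_ _≡_ v → (∀ x → c ≤ v x) →
                 Σ[ π ∈ Permutation′ k ] (∀ i → c ℕ.+ toℕ i ≤ v (π ⟨$⟩ʳ i))
sort-ascending zero c v _ _ = Perm.id , λ ()
sort-ascending (suc k) c v v-injective c≤v with argmin v
... | j , v-minimal with sort-ascending k (suc c) v-rest v-rest-injective c<v-rest
  where
  v-rest : Fin k → ℕ
  v-rest x = v (punchIn j x)
  v-rest-injective : Injective _≡_ _≡_ v-rest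
  v-rest-injective eq = FinP.punchIn-injective j _ _ (v-injective eq)
  c<v-rest : ∀ x → suc c ≤ v-rest x
  c<v-rest x = ℕP.<-≤-trans (s≤s (c≤v j))
    (ℕP.≤∧≢⇒< (v-minimal (punchIn j x)) (λ eq → FinP.punchInᵢ≢i j x (sym (v-injective eq))))
... | π , ascending = Perm.insert Fin.zero j π , bound
  where
  bound : ∀ i → c ℕ.+ toℕ i ≤ v (Perm.insert Fin.zero j π ⟨$⟩ʳ i)
  bound Fin.zero = ℕP.≤-trans (ℕP.≤-reflexive (ℕP.+-identityʳ c)) (c≤v j)
  bound (Fin.suc i) = subst₂ _≤_ (sym (ℕP.+-suc c (toℕ i)))
                        (cong v (sym (Perm.insert-punchIn Fin.zero j π i))) (ascending i)

sort-descending : ∀ k (v : Fin k → ℕ) → Injective _≡_ _≡_ v →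
                  Σ[ π ∈ Permutation′ k ] (∀ i → k ∸ suc (toℕ i) ≤ v (π ⟨$⟩ʳ i))
sort-descending k v v-injective with sort-ascending k 0 v v-injective (λ _ → z≤n)
... | π , ascending = Perm.reverse ∘ₚ π , λ i →
  subst (_≤ v (π ⟨$⟩ʳ opposite i)) (FinP.opposite-prop i) (ascending (opposite i))

prime∤⇒coprime : ∀ {p n} → Prime p → ¬ p ∣ n → Coprime n p
prime∤⇒coprime pp p∤n = Coprime.sym coprime
  where
  coprime : Coprime _ _
  coprime (d∣p , d∣n) with prime⇒irreducible pp d∣p
  ... | inj₁ d≡1 = d≡1
  ... | inj₂ refl = contradiction d∣n p∤n

∣∧<⇒≡0 : ∀ {d k} → d ∣ k → k < d → k ≡ 0
∣∧<⇒≡0 {k = zero} _ _ = refl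
∣∧<⇒≡0 {k = suc k} d∣k k<d = contradiction (∣⇒≤ d∣k) (ℕP.<⇒≱ k<d)

*-injective-mod : ∀ {N p x y} (z : ℤ) → Coprime N p → x < N → y < N →
                  + p * + y - + p * + x ≡ + N * z → x ≡ y
*-injective-mod {N} {p} {x} {y} z coprime x<N y<N eq =
  sym (ℤP.+-injective (ℤP.i-j≡0⇒i≡j (+ y) (+ x) (ℤP.∣i∣≡0⇒i≡0 (∣∧<⇒≡0 N∣distance distance<N))))
  where
  distance = ∣ + y - + x ∣
  p*distance≡N*∣z∣ : p ℕ.* distance ≡ N ℕ.* ∣ z ∣
  p*distance≡N*∣z∣ = begin
    p ℕ.* distance            ≡⟨ ℤP.abs-* (+ p) (+ y - + x) ⟨
    ∣ + p * (+ y - + x) ∣     ≡⟨ cong ∣_∣ (x[y-z]≈xy-xz (+ p) (+ y) (+ x)) ⟩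
    ∣ + p * + y - + p * + x ∣ ≡⟨ cong ∣_∣ eq ⟩
    ∣ + N * z ∣               ≡⟨ ℤP.abs-* (+ N) z ⟩
    N ℕ.* ∣ z ∣               ∎
    where open ≡-Reasoning
  N∣distance : N ∣ distance
  N∣distance = coprime-divisor coprime (divides ∣ z ∣ (trans p*distance≡N*∣z∣ (ℕP.*-comm N ∣ z ∣)))
  distance<N : distance < N
  distance<N = ℕP.≤-<-trans (subst (ℕ._≤ y ℕ.⊔ x) (cong ∣_∣ (sym (ℤP.[+m]-[+n]≡m⊖n y x))) (ℤP.∣m⊝n∣≤m⊔n y x))
                            (ℕP.⊔-lub y<N x<N)

-- Since ⌈ a / n ⌉ = - ⌊ - a / n ⌋, this is the division identity for - a.
+-*-⌈-/⌉≡%ℕ : ∀ a n → a + + suc n * ⌈ - a / suc n ⌉ ≡ + (a %ℕ suc n)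
+-*-⌈-/⌉≡%ℕ a n = begin
  a + N * - (- - a /ℕ suc n)                    ≡⟨ cong (λ b → a + N * - (b /ℕ suc n)) (ℤP.neg-involutive a) ⟩
  a + N * - (a /ℕ suc n)                        ≡⟨ cong (_+ N * - (a /ℕ suc n)) (a≡a%ℕn+[a/ℕn]*n a (suc n)) ⟩
  (+ (a %ℕ suc n) + (a /ℕ suc n) * N) + N * - (a /ℕ suc n) ≡⟨ cancel (+ (a %ℕ suc n)) (a /ℕ suc n) N ⟩
  + (a %ℕ suc n)                                ∎
  where
  open ≡-Reasoning
  N = + suc n
  cancel : ∀ r q N → (r + q * N) + N * - q ≡ r
  cancel = solve-∀

α≡%ℕ : ∀ n p i j → α (suc n) p i j ≡ + ((+ i - + p * + j) %ℕ suc n)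
α≡%ℕ n p i j = trans (cong (λ b → (+ i - + p * + j) + + suc n * ⌈ b / suc n ⌉) (flip (+ i) (+ p * + j)))
                     (+-*-⌈-/⌉≡%ℕ (+ i - + p * + j) n)
  where
  flip : ∀ a b → b - a ≡ - (a - b)
  flip = solve-∀

α-shift : ∀ n p i k j → α n p i j ≡ (α n p k j - (+ k - + i)) + + n * (⌈ + p * + j - + i / n ⌉ - ⌈ + p * + j - + k / n ⌉)
α-shift n p i k j = shift (+ i) (+ k) (+ p * + j) ⌈ + p * + j - + i / n ⌉ ⌈ + p * + j - + k / n ⌉ (+ n)
  where
  shift : ∀ i k P Qi Qk n → (i - P) + n * Qi ≡ (((k - P) + n * Qk) - (k - i)) + n * (Qi - Qk)
  shift = solve-∀

carry-ℕ : ∀ {N a r d} (e : ℤ) → r < N → + a ≡ (+ r - + d) + + N * e →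
          ∃[ c ] (e ≡ + c × a ℕ.+ d ≡ r ℕ.+ N ℕ.* c)
carry-ℕ {N} {a} {r} {d} (+ c) _ eq = c , refl , ℤP.+-injective (begin
  + a + + d                      ≡⟨ cong (_+ + d) eq ⟩
  ((+ r - + d) + + N * + c) + + d ≡⟨ cancel (+ r) (+ d) (+ N * + c) ⟩
  + r + + N * + c                ≡⟨ cong (λ x → + r + x) (ℤP.pos-* N c) ⟨
  + (r ℕ.+ N ℕ.* c)              ∎)
  where
  open ≡-Reasoning
  cancel : ∀ r d x → ((r - d) + x) + d ≡ r + x
  cancel = solve-∀
carry-ℕ {N} {a} {r} {d} -[1+ c ] r<N eq = contradiction N≤r (ℕP.<⇒≱ r<N)
  where
  open ≡-Reasoning
  cancel : ∀ r d N c → (((r - d) + N * - c) + d) + N * c ≡ r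
  cancel = solve-∀
  a+d+N[1+c]≡r : a ℕ.+ d ℕ.+ N ℕ.* suc c ≡ r
  a+d+N[1+c]≡r = ℤP.+-injective (begin
    + a + + d + + (N ℕ.* suc c)  ≡⟨ cong₂ (λ x y → x + + d + y) eq (ℤP.pos-* N (suc c)) ⟩
    (((+ r - + d) + + N * -[1+ c ]) + + d) + + N * + suc c ≡⟨ cancel (+ r) (+ d) (+ N) (+ suc c) ⟩
    + r                            ∎)
  N≤r : N ≤ r
  N≤r = ℕP.≤-trans (ℕP.m≤m*n N (suc c)) (ℕP.≤-trans (ℕP.m≤n+m _ (a ℕ.+ d)) (ℕP.≤-reflexive a+d+N[1+c]≡r))

carry≡0⇔≤ : ∀ {N a r d} c → a < N → a ℕ.+ d ≡ r ℕ.+ N ℕ.* c → (c ≡ 0 ⇔ d ≤ r)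
carry≡0⇔≤ {N} {a} {r} {d} zero _ eq = mk⇔ d≤r (λ _ → refl)
  where
  d≤r : 0 ≡ 0 → d ≤ r
  d≤r _ = ℕP.≤-trans (ℕP.m≤n+m d a) (ℕP.≤-reflexive (trans eq (trans (cong (r ℕ.+_) (ℕP.*-zeroʳ N)) (ℕP.+-identityʳ r))))
carry≡0⇔≤ {N} {a} {r} {d} (suc c) a<N eq = mk⇔ (λ ()) (λ d≤r → contradiction eq (ℕP.<⇒≢ (a+d< d≤r)))
  where
  open ℕP.≤-Reasoning
  a+d< : d ≤ r → a ℕ.+ d < r ℕ.+ N ℕ.* suc c
  a+d< d≤r = begin-strict
    a ℕ.+ d          <⟨ ℕP.+-monoˡ-< d a<N ⟩
    N ℕ.+ d          ≤⟨ ℕP.+-monoʳ-≤ N d≤r ⟩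
    N ℕ.+ r          ≡⟨ ℕP.+-comm N r ⟩
    r ℕ.+ N          ≤⟨ ℕP.+-monoʳ-≤ r (ℕP.m≤m*n N (suc c)) ⟩
    r ℕ.+ N ℕ.* suc c ∎

pos-∸ : ∀ {m n} → n ≤ m → + (m ∸ n) ≡ + m - + n
pos-∸ {m} {n} n≤m = sym (trans (ℤP.[+m]-[+n]≡m⊖n m n) (ℤP.⊖-≥ n≤m))

≡+-*⇔≡0 : ∀ x n e → x ≡ x + + suc n * e ⇔ e ≡ + 0
≡+-*⇔≡0 x n e = mk⇔ to from
  where
  to : x ≡ x + + suc n * e → e ≡ + 0
  to eq = ℤP.*-cancelˡ-≡ (+ suc n) e (+ 0) (begin
    + suc n * e                     ≡⟨ difference x (+ suc n * e) ⟩
    (x + + suc n * e) - x           ≡⟨ cong (_- x) eq ⟨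
    x - x                           ≡⟨ ℤP.+-inverseʳ x ⟩
    + 0                             ≡⟨ ℤP.*-zeroʳ (+ suc n) ⟨
    + suc n * + 0                   ∎)
    where
    open ≡-Reasoning
    difference : ∀ x y → y ≡ (x + y) - x
    difference = solve-∀
  from : e ≡ + 0 → x ≡ x + + suc n * e
  from refl = sym (trans (cong (λ y → x + y) (ℤP.*-zeroʳ (+ suc n))) (ℤP.+-identityʳ x))

module Rows (n p k : ℕ) where

  N : ℕ
  N = suc n

  r : ℕ → ℕ → ℕ
  r i j = (+ i - + p * + j) %ℕ N

  α≡r : ∀ i j → α N p i j ≡ + r i j
  α≡r i j = α≡%ℕ n p i j

  r<N : ∀ i j → r i j < N
  r<N i j = n%ℕd<d (+ i - + p * + j) N

  ⌈⌉-gap : ℕ → ℕ → ℤ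
  ⌈⌉-gap i j = ⌈ + p * + j - + i / N ⌉ - ⌈ + p * + j - + k / N ⌉

  record Carry (i j : ℕ) : Set where
    field
      value : ℕ
      ⌈⌉-gap≡ : ⌈⌉-gap i j ≡ + value
      r-equation : r i j ℕ.+ (k ∸ i) ≡ r k j ℕ.+ N ℕ.* value

  r-shift : ∀ {i} j → i ≤ k → + r i j ≡ (+ r k j - + (k ∸ i)) + + N * ⌈⌉-gap i j
  r-shift {i} j i≤k = begin
    + r i j                                       ≡⟨ α≡r i j ⟨
    α N p i j                                     ≡⟨ α-shift N p i k j ⟩
    (α N p k j - (+ k - + i)) + + N * ⌈⌉-gap i j  ≡⟨ cong₂ (λ a b → (a - b) + + N * ⌈⌉-gap i j) (α≡r k j) (sym (pos-∸ i≤k)) ⟩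
    (+ r k j - + (k ∸ i)) + + N * ⌈⌉-gap i j      ∎
    where open ≡-Reasoning

  carry : ∀ {i} j → i ≤ k → Carry i j
  carry {i} j i≤k with carry-ℕ (⌈⌉-gap i j) (r<N k j) (r-shift j i≤k)
  ... | c , gap≡c , equation = record { value = c ; ⌈⌉-gap≡ = gap≡c ; r-equation = equation }

  module _ {i j} (i≤k : i ≤ k) (c : Carry i j) where
    open Carry c

    ⌈⌉-gap≡0⇔ : ⌈⌉-gap i j ≡ + 0 ⇔ value ≡ 0
    ⌈⌉-gap≡0⇔ = mk⇔ (λ gap≡0 → ℤP.+-injective (trans (sym ⌈⌉-gap≡) gap≡0)) (λ { refl → ⌈⌉-gap≡ })

    condition-b⇔ : + suc k - + i - + 1 ℤ.≤ α N p k j ⇔ value ≡ 0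
    condition-b⇔ = ⇔-sym (carry≡0⇔≤ value (r<N i j) r-equation)
               ⇔-∘ (mk⇔ ℤP.drop‿+≤+ ℤ.+≤+
               ⇔-∘ subst₂-⇔ ℤ._≤_ (trans (shift (+ i) (+ k)) (sym (pos-∸ i≤k))) (α≡r k j))
      where
      shift : ∀ i k → + 1 + k - i - + 1 ≡ k - i
      shift = solve-∀

    condition-c⇔ : + i + + 1 - + suc k + α N p k j ≡ α N p i j ⇔ value ≡ 0
    condition-c⇔ = ⌈⌉-gap≡0⇔
               ⇔-∘ (≡+-*⇔≡0 (α N p k j - (+ k - + i)) n (⌈⌉-gap i j)
               ⇔-∘ subst₂-⇔ _≡_ (shift (+ i) (+ k) (α N p k j)) (α-shift N p i k j))
      where
      shift : ∀ i k a → i + + 1 - (+ 1 + k) + a ≡ a - (k - i)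
      shift = solve-∀

    condition-d⇔ : ⌈ + p * + j - + i / N ⌉ ≡ ⌈ + p * + j - + suc k + + 1 / N ⌉ ⇔ value ≡ 0
    condition-d⇔ = ⌈⌉-gap≡0⇔
               ⇔-∘ (mk⇔ ℤP.i≡j⇒i-j≡0 (ℤP.i-j≡0⇒i≡j _ _)
               ⇔-∘ subst₂-⇔ _≡_ refl (cong ⌈_/ N ⌉ (shift (+ p * + j) (+ k))))
      where
      shift : ∀ P k → P - (+ 1 + k) + + 1 ≡ P - k
      shift = solve-∀

module Minimality (n p k : ℕ) (coprime : Coprime (suc n) p) (m<N : suc k < suc n) where
  open Rows n p k

  m : ℕ
  m = suc k

  toℕ≤k : (i : Fin m) → toℕ i ≤ k
  toℕ≤k i = ℕP.≤-pred (FinP.toℕ<n i)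

  toℕ<N : (i : Fin m) → toℕ i < N
  toℕ<N i = ℕP.<-trans (FinP.toℕ<n i) m<N

  carry-of : (σ : Permutation′ m) (i : Fin m) → Carry (toℕ i) (toℕ (σ ⟨$⟩ʳ i))
  carry-of σ i = carry (toℕ (σ ⟨$⟩ʳ i)) (toℕ≤k i)

  carries : Permutation′ m → Fin m → ℕ
  carries σ i = Carry.value (carry-of σ i)

  r-row : Permutation′ m → Fin m → ℕ
  r-row σ i = r (toℕ i) (toℕ (σ ⟨$⟩ʳ i))

  r-last-row : Fin m → ℕ
  r-last-row j = r k (toℕ j)

  r-last-row-injective : Injective _≡_ _≡_ r-last-row
  r-last-row-injective {x} {y} eq =
    FinP.toℕ-injective (*-injective-mod _ coprime (toℕ<N x) (toℕ<N y) (begin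
      P y - P x                                  ≡⟨ difference (+ k) (P x) (P y) (Q x) (Q y) (+ N) ⟩
      (α N p k x′ - α N p k y′) + + N * (Q y - Q x) ≡⟨ cong (_+ + N * (Q y - Q x)) α-equal ⟩
      + 0 + + N * (Q y - Q x)                     ≡⟨ ℤP.+-identityˡ _ ⟩
      + N * (Q y - Q x)                           ∎))
    where
    open ≡-Reasoning
    x′ = toℕ x
    y′ = toℕ y
    P : Fin m → ℤ
    P z = + p * + toℕ z
    Q : Fin m → ℤ
    Q z = ⌈ P z - + k / N ⌉
    difference : ∀ k Px Py Qx Qy N → Py - Px ≡ (((k - Px) + N * Qx) - ((k - Py) + N * Qy)) + N * (Qy - Qx)
    difference = solve-∀
    α-equal : α N p k x′ - α N p k y′ ≡ + 0
    α-equal = ℤP.i≡j⇒i-j≡0 (trans (α≡r k x′) (trans (cong +_ eq) (sym (α≡r k y′))))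

  distance-to-k : Fin m → ℕ
  distance-to-k i = k ∸ toℕ i

  r-sum : Permutation′ m → ℕ
  r-sum σ = sum (r-row σ)

  cost≡r-sum : ∀ σ → cost N p m σ ≡ + r-sum σ
  cost≡r-sum σ = Σ≡+sum m (λ i → α≡r (toℕ i) (toℕ (σ ⟨$⟩ʳ i)))

  r-sum-identity : ∀ σ → r-sum σ ℕ.+ sum distance-to-k ≡ sum r-last-row ℕ.+ N ℕ.* sum (carries σ)
  r-sum-identity σ = begin
    r-sum σ ℕ.+ sum distance-to-k                                ≡⟨ ∑-distrib-+ (r-row σ) distance-to-k ⟨
    sum (λ i → r-row σ i ℕ.+ distance-to-k i)                    ≡⟨ sum-cong-≗ (λ i → Carry.r-equation (carry-of σ i)) ⟩
    sum (λ i → r-last-row (σ ⟨$⟩ʳ i) ℕ.+ N ℕ.* carries σ i)      ≡⟨ ∑-distrib-+ (λ i → r-last-row (σ ⟨$⟩ʳ i)) (λ i → N ℕ.* carries σ i) ⟩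
    sum (λ i → r-last-row (σ ⟨$⟩ʳ i)) ℕ.+ sum (λ i → N ℕ.* carries σ i)
      ≡⟨ cong₂ ℕ._+_ (sum-permute r-last-row σ) (*-distribˡ-sum N (carries σ)) ⟨
    sum r-last-row ℕ.+ N ℕ.* sum (carries σ)                     ∎
    where open ≡-Reasoning

  cost≤⇔carries≤ : ∀ δ σ → cost N p m δ ℤ.≤ cost N p m σ ⇔ sum (carries δ) ≤ sum (carries σ)
  cost≤⇔carries≤ δ σ =
        mk⇔ (ℕP.*-cancelˡ-≤ N) (ℕP.*-monoʳ-≤ N)
    ⇔-∘ (mk⇔ (ℕP.+-cancelˡ-≤ (sum r-last-row) _ _) (ℕP.+-monoʳ-≤ (sum r-last-row))
    ⇔-∘ (subst₂-⇔ _≤_ (r-sum-identity δ) (r-sum-identity σ)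
    ⇔-∘ (mk⇔ (ℕP.+-monoˡ-≤ (sum distance-to-k)) (ℕP.+-cancelʳ-≤ (sum distance-to-k) _ _)
    ⇔-∘ (mk⇔ ℤP.drop‿+≤+ ℤ.+≤+
    ⇔-∘ subst₂-⇔ ℤ._≤_ (cost≡r-sum δ) (cost≡r-sum σ)))))

  σ₀ : Permutation′ m
  σ₀ = proj₁ (sort-descending m r-last-row r-last-row-injective)

  carries-σ₀≡0 : ∀ i → carries σ₀ i ≡ 0
  carries-σ₀≡0 i = Equivalence.from (carry≡0⇔≤ _ (r<N _ _) (Carry.r-equation (carry-of σ₀ i)))
                     (proj₂ (sort-descending m r-last-row r-last-row-injective) i)

  InSm0⇔carries≡0 : ∀ δ → InSm0 N p m δ ⇔ (∀ i → carries δ i ≡ 0)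
  InSm0⇔carries≡0 δ = mk⇔ to from
    where
    to : InSm0 N p m δ → ∀ i → carries δ i ≡ 0
    to minimal = sum≡0⇒≡0 (carries δ) (ℕP.n≤0⇒n≡0 (ℕP.≤-trans
                   (Equivalence.to (cost≤⇔carries≤ δ σ₀) (minimal σ₀))
                   (ℕP.≤-reflexive (≡0⇒sum≡0 (carries σ₀) carries-σ₀≡0))))
    from : (∀ i → carries δ i ≡ 0) → InSm0 N p m δ
    from carries≡0 σ = Equivalence.from (cost≤⇔carries≤ δ σ)
                         (subst (_≤ sum (carries σ)) (sym (≡0⇒sum≡0 (carries δ) carries≡0)) z≤n)

proposition3p3 : (n p m : ℕ) → 1 < n → Prime p → ¬ (p ∣ n) → 2 ≤ m → m < n →
    (δ : Permutation′ m) →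
    (InSm0 n p m δ ⇔ (∀ (i : Fin m) → + m - + toℕ i - + 1 ℤ.≤ α n p (ℕ.pred m) (toℕ (δ ⟨$⟩ʳ i))))
    × (InSm0 n p m δ ⇔ (∀ (i : Fin m) → + toℕ i + + 1 - + m + α n p (ℕ.pred m) (toℕ (δ ⟨$⟩ʳ i)) ≡ α n p (toℕ i) (toℕ (δ ⟨$⟩ʳ i))))
    × (InSm0 n p m δ ⇔ (∀ (i : Fin m) → ⌈ + p ℤ.* + toℕ (δ ⟨$⟩ʳ i) - + toℕ i / n ⌉ ≡ ⌈ + p ℤ.* + toℕ (δ ⟨$⟩ʳ i) - + m + + 1 / n ⌉))
-- The hypotheses 1 < n and 2 ≤ m only serve to exclude n = 0 and m = 0.
proposition3p3 (suc n) p (suc k) _ p-prime p∤n _ m<n δ =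
    via (λ i → condition-b⇔ (toℕ≤k i) (carry-of δ i))
  , via (λ i → condition-c⇔ (toℕ≤k i) (carry-of δ i))
  , via (λ i → condition-d⇔ (toℕ≤k i) (carry-of δ i))
  where
  open Rows n p k
  open Minimality n p k (prime∤⇒coprime p-prime p∤n) m<n
  via : {X : Fin m → Set} → (∀ i → X i ⇔ carries δ i ≡ 0) → InSm0 N p m δ ⇔ (∀ i → X i)
  via X⇔ = Π-cong-⇔ (λ i → ⇔-sym (X⇔ i)) ⇔-∘ InSm0⇔carries≡0 δ
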